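{- Let $N=\{1,\dots,n\}$, let $H\subseteq 2^N\setminus\{\varnothing,N\}$ be a poset ordered by inclusion, and suppose its two top layers $T_H$ are closed under intersection. Let $h$ be the number of nodes in the upper layer, $\ell$ their common cardinality, $N'=\bigcup_{x\text{ in the upper layer}}x$ and $n'=|N'|\le n$. Then: (1) If every node $y$ of the lower layer satisfies $|\mathsf{prec}(y)|\le 2$ and $h\ge 2$, then $\ell=n'-1$, i.e. the upper-layer nodes are of the form $N'\setminus\{i\}$, and the lower layer contains exactly $\frac{h(h-1)}{2}$ nodes having exactly $2$ predecessors. (2) If $h\ge 3$ and there is a node $S$ of the lower layer with $|\mathsf{prec}(S)|=h$, then $h=n'-\ell+1$ and $\ell<n'-1$, the upper-layer nodes are exactly the sets $S\cup\{i\}$ with $i\in N'\setminus S$, and every node $T\neq S$ of the lower layer has $0$ or $1$ predecessor.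
   Context: Nodes are the elements of $H$. $\ell$ is the maximum cardinality of a node of $H$. $T_H$ consists of the upper layer (nodes of $H$ of cardinality $\ell$) and the lower layer (nodes of $H$ of cardinality $\ell-1$), ordered by inclusion. For $y$ in the lower layer, $\mathsf{prec}(y)$ is the set of upper nodes containing $y$ (its predecessors); for $x$ in the upper layer, $\mathsf{succ}(x)$ is the set of lower nodes contained in $x$. $T_H$ is closed under intersection if $|\mathsf{succ}(x)\cap\mathsf{succ}(x')|=1$ (i.e. $x\cap x'$ belongs to the lower layer) for every two distinct upper nodes $x,x'$. -}

module Defs where

open import Data.Nat using (ℕ; _⊔_; _∸_; _≟_)
open import Data.List using (List; filter; length; foldr; map)
open import Data.List.Membership.Propositional using (_∈_)
open import Data.Fin.Subset using (Subset; ∣_∣; _⊆_; _∩_)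
open import Data.Fin.Subset.Properties using (_⊆?_)
open import Data.Product using (_×_)
open import Relation.Binary.PropositionalEquality using (_≡_; _≢_)

-- H is represented by a duplicate-free list of subsets of N = Fin n.

-- ℓ : maximum cardinality of a node of H (0 if H is empty)
maxCard : ∀ {n} → List (Subset n) → ℕ
maxCard H = foldr _⊔_ 0 (map ∣_∣ H)

upper : ∀ {n} → List (Subset n) → List (Subset n)
upper H = filter (λ x → ∣ x ∣ ≟ maxCard H) H

lower : ∀ {n} → List (Subset n) → List (Subset n)
lower H = filter (λ x → ∣ x ∣ ≟ maxCard H ∸ 1) H

prec : ∀ {n} → List (Subset n) → Subset n → List (Subset n)
prec H y = filter (λ x → y ⊆? x) (upper H)

-- T_H closed under intersection: for distinct upper x, x', x ∩ x' is in the lower layer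
-- (equivalently |succ(x) ∩ succ(x')| = 1)
ClosedUnderIntersection : ∀ {n} → List (Subset n) → Set
ClosedUnderIntersection H =
  ∀ x x' → x ∈ upper H → x' ∈ upper H → x ≢ x' → (x ∩ x') ∈ lower H

-- Two distinct upper nodes x, x′ meet in a lower node, so |x ∪ x′| = ℓ + 1 by inclusion–exclusion.
-- (1) If no lower node lies below three upper nodes, any further upper node z is the union of the lower
-- nodes z ∩ x and z ∩ x′, hence lies in x ∪ x′; so N′ = x ∪ x′ and every upper node is N′ minus a point.
-- Each pair of upper nodes has exactly one common lower node, and each lower node has at most two upper
-- nodes above it, so double counting gives h(h − 1)/2 lower nodes with two predecessors.
-- (2) If S lies below all h upper nodes, each of them is S plus one new point, distinct for distinct
-- nodes, so |N′| = |S| + h. Any lower node below two upper nodes is their intersection, hence S.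

module Submission where

open import Defs
open import Data.Nat using (ℕ; _+_; _*_; _∸_; _≤_; _<_; _/_)
open import Data.List using (List; length; filter)
open import Data.List.Membership.Propositional using (_∈_)
open import Data.List.Relation.Unary.Unique.Propositional using (Unique)
open import Data.Fin using (Fin)
open import Data.Fin.Subset using (Subset; ⊥; ⊤; ∣_∣; ⋃; _∪_; _-_; ⁅_⁆; _∉_) renaming (_∈_ to _∈ₛ_)
open import Data.Product using (_×_; ∃; ∃-syntax; _,_)
open import Data.Nat using (_≟_)
open import Relation.Binary.PropositionalEquality using (_≡_; _≢_)
open import Function.Bundles using (_⇔_)

open import Data.Nat using (zero; suc; z≤n; s≤s; ≢-nonZero)
open import Data.Nat.Properties
open import Data.Nat.ListAction using (sum)
open import Data.Nat.DivMod using (+-distrib-/-∣ʳ; m*n/n≡m)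
open import Data.Nat.Divisibility using (divides-refl)
open import Data.Vec using ([]; _∷_; here)
open import Data.Vec.Properties using (≡-dec)
open import Data.Fin.Subset using (_⊆_; _⊂_; _∩_; outside; inside)
open import Data.Fin.Subset.Properties
  using (_⊆?_; drop-∷-⊆; out⊂; out⊂in; in⊂in; p⊂q⇒∣p∣<∣q∣; ⊆-antisym; ⊆-trans; ⊥⊆; ∣⊥∣≡0;
         ∉⊥; p∩q⊆p; p∩q⊆q; x∈p∩q⁺; p⊆p∪q; q⊆p∪q; x∈p∪q⁻; x∈⁅x⁆; x∈⁅y⁆⇒x≡y; ∣⁅x⁆∣≡1;
         x∈p∧x≢y⇒x∈p-y; x∈p⇒∣p-x∣<∣p∣; ⊆-reflexive; ⊆-refl; ∪-assoc; ∪-comm; ∪-idem; ∪-identityʳ)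
open import Data.List using ([]; _∷_; map)
open import Data.List.Properties using (filter-complete; filter-none)
open import Data.List.Relation.Unary.Any using (here; there)
import Data.List.Relation.Unary.All as All
open import Data.List.Relation.Unary.All using (_∷_)
open import Data.List.Relation.Unary.AllPairs using (_∷_)
open import Data.List.Membership.Propositional.Properties using (∈-filter⁻; ∈-filter⁺)
open import Data.List.Relation.Unary.Unique.Propositional.Properties using (filter⁺)
open import Data.Product using (∃!; ∃₂; proj₁; proj₂)
open import Data.Sum using (_⊎_; inj₁; inj₂; [_,_]′)
import Data.Sum as Sum
open import Data.Bool.Properties using () renaming (_≟_ to _≟ᵇ_)
open import Function using (_∘_; id)
open import Function.Bundles using (mk⇔)
open import Relation.Binary.PropositionalEquality using (refl; sym; trans; cong; cong₂; subst; subst₂; ≢-sym; module ≡-Reasoning)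
open import Relation.Nullary using (¬_; Dec; yes; no; contradiction)
open import Relation.Unary using (Decidable)
open import Data.Empty using (⊥-elim) renaming (⊥ to ⊥ₑ)
open import Algebra.Properties.CommutativeSemigroup +-commutativeSemigroup using (interchange)

private
  variable
    A B : Set
    n : ℕ
    p q r : Subset n

-- Subsets of a finite set

p⊆q⇒p≡q⊎p⊂q : p ⊆ q → p ≡ q ⊎ p ⊂ q
p⊆q⇒p≡q⊎p⊂q {p = []}          {[]}          _   = inj₁ refl
p⊆q⇒p≡q⊎p⊂q {p = outside ∷ p} {outside ∷ q} p⊆q = Sum.map (cong (outside ∷_)) out⊂ (p⊆q⇒p≡q⊎p⊂q (drop-∷-⊆ p⊆q))
p⊆q⇒p≡q⊎p⊂q {p = outside ∷ p} {inside  ∷ q} p⊆q = inj₂ (out⊂in (drop-∷-⊆ p⊆q))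
p⊆q⇒p≡q⊎p⊂q {p = inside  ∷ p} {outside ∷ q} p⊆q = contradiction (p⊆q here) λ ()
p⊆q⇒p≡q⊎p⊂q {p = inside  ∷ p} {inside  ∷ q} p⊆q = Sum.map (cong (inside ∷_)) in⊂in (p⊆q⇒p≡q⊎p⊂q (drop-∷-⊆ p⊆q))

p⊆q∧∣q∣≤∣p∣⇒p≡q : p ⊆ q → ∣ q ∣ ≤ ∣ p ∣ → p ≡ q
p⊆q∧∣q∣≤∣p∣⇒p≡q p⊆q ∣q∣≤∣p∣ =
  [ id , (λ p⊂q → contradiction (p⊂q⇒∣p∣<∣q∣ p⊂q) (≤⇒≯ ∣q∣≤∣p∣)) ]′ (p⊆q⇒p≡q⊎p⊂q p⊆q)

p⊆q∧∣p∣<∣q∣⇒p⊂q : p ⊆ q → ∣ p ∣ < ∣ q ∣ → p ⊂ q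
p⊆q∧∣p∣<∣q∣⇒p⊂q p⊆q ∣p∣<∣q∣ =
  [ (λ { refl → contradiction ∣p∣<∣q∣ (<-irrefl refl) }) , id ]′ (p⊆q⇒p≡q⊎p⊂q p⊆q)

p≢⊥⇒∣p∣≢0 : p ≢ ⊥ → ∣ p ∣ ≢ 0
p≢⊥⇒∣p∣≢0 {n} p≢⊥ ∣p∣≡0 =
  p≢⊥ (sym (p⊆q∧∣q∣≤∣p∣⇒p≡q ⊥⊆ (≤-reflexive (trans ∣p∣≡0 (sym (∣⊥∣≡0 n))))))

∪-lub : p ⊆ r → q ⊆ r → p ∪ q ⊆ r
∪-lub {p = p} {q = q} p⊆r q⊆r x∈p∪q = [ p⊆r , q⊆r ]′ (x∈p∪q⁻ p q x∈p∪q)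

∩-glb : r ⊆ p → r ⊆ q → r ⊆ p ∩ q
∩-glb r⊆p r⊆q x∈r = x∈p∩q⁺ (r⊆p x∈r , r⊆q x∈r)

∣p∪q∣+∣p∩q∣≡∣p∣+∣q∣ : (p q : Subset n) → ∣ p ∪ q ∣ + ∣ p ∩ q ∣ ≡ ∣ p ∣ + ∣ q ∣
∣p∪q∣+∣p∩q∣≡∣p∣+∣q∣ []            []            = refl
∣p∪q∣+∣p∩q∣≡∣p∣+∣q∣ (outside ∷ p) (outside ∷ q) = ∣p∪q∣+∣p∩q∣≡∣p∣+∣q∣ p q
∣p∪q∣+∣p∩q∣≡∣p∣+∣q∣ (inside  ∷ p) (outside ∷ q) = cong suc (∣p∪q∣+∣p∩q∣≡∣p∣+∣q∣ p q)
∣p∪q∣+∣p∩q∣≡∣p∣+∣q∣ (outside ∷ p) (inside  ∷ q)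
  rewrite +-suc ∣ p ∣ ∣ q ∣ = cong suc (∣p∪q∣+∣p∩q∣≡∣p∣+∣q∣ p q)
∣p∪q∣+∣p∩q∣≡∣p∣+∣q∣ (inside  ∷ p) (inside  ∷ q)
  rewrite +-suc ∣ p ∪ q ∣ ∣ p ∩ q ∣ | +-suc ∣ p ∣ ∣ q ∣ = cong (suc ∘ suc) (∣p∪q∣+∣p∩q∣≡∣p∣+∣q∣ p q)

x∈p⇒⁅x⁆⊆p : ∀ {x : Fin n} → x ∈ₛ p → ⁅ x ⁆ ⊆ p
x∈p⇒⁅x⁆⊆p {p = p} {x} x∈p y∈⁅x⁆ = subst (_∈ₛ p) (sym (x∈⁅y⁆⇒x≡y x y∈⁅x⁆)) x∈p

x∉p⇒∣p∪⁅x⁆∣≡1+∣p∣ : ∀ {x : Fin n} → x ∉ p → ∣ p ∪ ⁅ x ⁆ ∣ ≡ suc ∣ p ∣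
x∉p⇒∣p∪⁅x⁆∣≡1+∣p∣ {p = p} {x} x∉p = ≤-antisym ∣p∪⁅x⁆∣≤1+∣p∣ (p⊂q⇒∣p∣<∣q∣ p⊂p∪⁅x⁆)
  where
  open ≤-Reasoning
  ∣p∪⁅x⁆∣≤1+∣p∣ : ∣ p ∪ ⁅ x ⁆ ∣ ≤ suc ∣ p ∣
  ∣p∪⁅x⁆∣≤1+∣p∣ = begin
    ∣ p ∪ ⁅ x ⁆ ∣                   ≤⟨ m≤m+n _ _ ⟩
    ∣ p ∪ ⁅ x ⁆ ∣ + ∣ p ∩ ⁅ x ⁆ ∣   ≡⟨ ∣p∪q∣+∣p∩q∣≡∣p∣+∣q∣ p ⁅ x ⁆ ⟩
    ∣ p ∣ + ∣ ⁅ x ⁆ ∣               ≡⟨ cong (∣ p ∣ +_) (∣⁅x⁆∣≡1 x) ⟩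
    ∣ p ∣ + 1                       ≡⟨ +-comm ∣ p ∣ 1 ⟩
    suc ∣ p ∣                       ∎
  p⊂p∪⁅x⁆ : p ⊂ p ∪ ⁅ x ⁆
  p⊂p∪⁅x⁆ = p⊆p∪q ⁅ x ⁆ , x , q⊆p∪q p ⁅ x ⁆ (x∈⁅x⁆ x) , x∉p

p⊆q∧∣q∣≡1+∣p∣⇒p≡q-x : p ⊆ q → ∣ q ∣ ≡ suc ∣ p ∣ → ∃[ x ] (x ∈ₛ q × p ≡ q - x)
p⊆q∧∣q∣≡1+∣p∣⇒p≡q-x {p = p} {q} p⊆q ∣q∣≡1+∣p∣
  with _ , x , x∈q , x∉p ← p⊆q∧∣p∣<∣q∣⇒p⊂q p⊆q (≤-reflexive (sym ∣q∣≡1+∣p∣))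
  = x , x∈q , p⊆q∧∣q∣≤∣p∣⇒p≡q p⊆q-x (≤-pred (subst (suc ∣ q - x ∣ ≤_) ∣q∣≡1+∣p∣ (x∈p⇒∣p-x∣<∣p∣ x∈q)))
  where
  p⊆q-x : p ⊆ q - x
  p⊆q-x y∈p = x∈p∧x≢y⇒x∈p-y (p⊆q y∈p) (λ { refl → x∉p y∈p })

p⊆q∧∣q∣≡1+∣p∣⇒q≡p∪⁅x⁆ : p ⊆ q → ∣ q ∣ ≡ suc ∣ p ∣ → ∃[ x ] (x ∉ p × q ≡ p ∪ ⁅ x ⁆)
p⊆q∧∣q∣≡1+∣p∣⇒q≡p∪⁅x⁆ {p = p} {q} p⊆q ∣q∣≡1+∣p∣
  with _ , x , x∈q , x∉p ← p⊆q∧∣p∣<∣q∣⇒p⊂q p⊆q (≤-reflexive (sym ∣q∣≡1+∣p∣))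
  = x , x∉p , sym (p⊆q∧∣q∣≤∣p∣⇒p≡q (∪-lub p⊆q (x∈p⇒⁅x⁆⊆p x∈q))
                     (≤-reflexive (trans ∣q∣≡1+∣p∣ (sym (x∉p⇒∣p∪⁅x⁆∣≡1+∣p∣ x∉p)))))

p∈xs⇒p⊆⋃xs : ∀ {xs : List (Subset n)} → p ∈ xs → p ⊆ ⋃ xs
p∈xs⇒p⊆⋃xs {xs = _ ∷ xs} (here refl) = p⊆p∪q (⋃ xs)
p∈xs⇒p⊆⋃xs {xs = x ∷ xs} (there p∈xs) = ⊆-trans (p∈xs⇒p⊆⋃xs p∈xs) (q⊆p∪q x (⋃ xs))

⋃-lub : ∀ (xs : List (Subset n)) → (∀ {x} → x ∈ xs → x ⊆ r) → ⋃ xs ⊆ r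
⋃-lub []       _    = λ i∈⊥ → contradiction i∈⊥ ∉⊥
⋃-lub (x ∷ xs) xs⊆r = ∪-lub (xs⊆r (here refl)) (⋃-lub xs (xs⊆r ∘ there))

i∈⋃xs⇒∃x : ∀ {i : Fin n} (xs : List (Subset n)) → i ∈ₛ ⋃ xs → ∃[ x ] (x ∈ xs × i ∈ₛ x)
i∈⋃xs⇒∃x []       i∈⊥ = contradiction i∈⊥ ∉⊥
i∈⋃xs⇒∃x (x ∷ xs) i∈ with x∈p∪q⁻ x (⋃ xs) i∈
... | inj₁ i∈x  = x , here refl , i∈x
... | inj₂ i∈xs with y , y∈xs , i∈y ← i∈⋃xs⇒∃x xs i∈xs = y , there y∈xs , i∈y

OnePointExtension : Subset n → Subset n → Set
OnePointExtension p x = ∃[ i ] (i ∉ p × x ≡ p ∪ ⁅ i ⁆)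

∣p∪⋃xs∣≡∣p∣+length : ∀ {xs : List (Subset n)} → Unique xs → (∀ {x} → x ∈ xs → OnePointExtension p x) →
                     ∣ p ∪ ⋃ xs ∣ ≡ ∣ p ∣ + length xs
∣p∪⋃xs∣≡∣p∣+length {p = p} {[]} _ _ = trans (cong ∣_∣ (∪-identityʳ p)) (sym (+-identityʳ ∣ p ∣))
∣p∪⋃xs∣≡∣p∣+length {p = p} {x ∷ xs} (x∉xs ∷ xs-unique) ext with ext (here refl)
... | i , i∉p , refl = begin
  ∣ p ∪ ((p ∪ ⁅ i ⁆) ∪ ⋃ xs) ∣  ≡⟨ cong ∣_∣ regroup ⟩
  ∣ (p ∪ ⋃ xs) ∪ ⁅ i ⁆ ∣        ≡⟨ x∉p⇒∣p∪⁅x⁆∣≡1+∣p∣ i∉p∪⋃xs ⟩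
  suc ∣ p ∪ ⋃ xs ∣              ≡⟨ cong suc (∣p∪⋃xs∣≡∣p∣+length xs-unique (ext ∘ there)) ⟩
  suc (∣ p ∣ + length xs)       ≡⟨ +-suc ∣ p ∣ (length xs) ⟨
  ∣ p ∣ + suc (length xs)       ∎
  where
  open ≡-Reasoning
  regroup : p ∪ ((p ∪ ⁅ i ⁆) ∪ ⋃ xs) ≡ (p ∪ ⋃ xs) ∪ ⁅ i ⁆
  regroup = begin
    p ∪ ((p ∪ ⁅ i ⁆) ∪ ⋃ xs)  ≡⟨ cong (p ∪_) (∪-assoc p ⁅ i ⁆ (⋃ xs)) ⟩
    p ∪ (p ∪ (⁅ i ⁆ ∪ ⋃ xs))  ≡⟨ ∪-assoc p p _ ⟨
    (p ∪ p) ∪ (⁅ i ⁆ ∪ ⋃ xs)  ≡⟨ cong (_∪ (⁅ i ⁆ ∪ ⋃ xs)) (∪-idem p) ⟩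
    p ∪ (⁅ i ⁆ ∪ ⋃ xs)        ≡⟨ cong (p ∪_) (∪-comm ⁅ i ⁆ (⋃ xs)) ⟩
    p ∪ (⋃ xs ∪ ⁅ i ⁆)        ≡⟨ ∪-assoc p (⋃ xs) ⁅ i ⁆ ⟨
    (p ∪ ⋃ xs) ∪ ⁅ i ⁆        ∎
  -- The new points of distinct extensions are distinct.
  i∉⋃xs : i ∉ ⋃ xs
  i∉⋃xs i∈⋃xs with y , y∈xs , i∈y ← i∈⋃xs⇒∃x xs i∈⋃xs with ext (there y∈xs)
  ... | j , _ , refl with x∈p∪q⁻ p ⁅ j ⁆ i∈y
  ... | inj₁ i∈p  = i∉p i∈p
  ... | inj₂ i∈⁅j⁆ rewrite x∈⁅y⁆⇒x≡y j i∈⁅j⁆ = All.lookup x∉xs y∈xs refl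
  i∉p∪⋃xs : i ∉ p ∪ ⋃ xs
  i∉p∪⋃xs i∈ = [ i∉p , i∉⋃xs ]′ (x∈p∪q⁻ p (⋃ xs) i∈)

_≟ₛ_ : (p q : Subset n) → Dec (p ≡ q)
_≟ₛ_ = ≡-dec _≟ᵇ_

0<length⇒∃∈ : ∀ {xs : List A} → 0 < length xs → ∃[ x ] x ∈ xs
0<length⇒∃∈ {xs = x ∷ _} _ = x , here refl

Unique∧2≤length⇒∃≢ : ∀ {xs : List A} → Unique xs → 2 ≤ length xs → ∃₂ λ a b → a ∈ xs × b ∈ xs × a ≢ b
Unique∧2≤length⇒∃≢ {xs = a ∷ b ∷ _} ((a≢b ∷ _) ∷ _) _ = a , b , here refl , there (here refl) , a≢b
Unique∧2≤length⇒∃≢ {xs = _ ∷ []}    _               (s≤s ())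

≢∧∈∧∈⇒2≤length : ∀ {a b : A} {xs} → a ∈ xs → b ∈ xs → a ≢ b → 2 ≤ length xs
≢∧∈∧∈⇒2≤length (here refl) (here refl)               a≢b = contradiction refl a≢b
≢∧∈∧∈⇒2≤length (here refl) (there {xs = _ ∷ _} _)   _   = s≤s (s≤s z≤n)
≢∧∈∧∈⇒2≤length (there {xs = _ ∷ _} _) (here refl)   _   = s≤s (s≤s z≤n)
≢∧∈∧∈⇒2≤length (there a∈xs) (there b∈xs)             a≢b = m≤n⇒m≤1+n (≢∧∈∧∈⇒2≤length a∈xs b∈xs a≢b)

≢∧∈∧∈∧∈⇒3≤length : ∀ {a b c : A} {xs} → a ∈ xs → b ∈ xs → c ∈ xs → a ≢ b → a ≢ c → b ≢ c → 3 ≤ length xs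
≢∧∈∧∈∧∈⇒3≤length (here refl)  (here refl)  _            a≢b _   _   = contradiction refl a≢b
≢∧∈∧∈∧∈⇒3≤length (here refl)  (there _)    (here refl)  _   a≢c _   = contradiction refl a≢c
≢∧∈∧∈∧∈⇒3≤length (here refl)  (there b∈xs) (there c∈xs) _   _   b≢c = s≤s (≢∧∈∧∈⇒2≤length b∈xs c∈xs b≢c)
≢∧∈∧∈∧∈⇒3≤length (there _)    (here refl)  (here refl)  _   _   b≢c = contradiction refl b≢c
≢∧∈∧∈∧∈⇒3≤length (there a∈xs) (here refl)  (there c∈xs) _   a≢c _   = s≤s (≢∧∈∧∈⇒2≤length a∈xs c∈xs a≢c)
≢∧∈∧∈∧∈⇒3≤length (there a∈xs) (there b∈xs) (here refl)  a≢b _   _   = s≤s (≢∧∈∧∈⇒2≤length a∈xs b∈xs a≢b)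
≢∧∈∧∈∧∈⇒3≤length (there a∈xs) (there b∈xs) (there c∈xs) a≢b a≢c b≢c =
  m≤n⇒m≤1+n (≢∧∈∧∈∧∈⇒3≤length a∈xs b∈xs c∈xs a≢b a≢c b≢c)

n≡m+n∸[1+m]+1 : ∀ m {n} → 0 < n → n ≡ m + n ∸ suc m + 1
n≡m+n∸[1+m]+1 m {suc k} _ = begin
  suc k                  ≡⟨ +-comm 1 k ⟩
  k + 1                  ≡⟨ cong (_+ 1) (m+n∸m≡n m k) ⟨
  m + k ∸ m + 1          ≡⟨ cong (λ t → t ∸ suc m + 1) (+-suc m k) ⟨
  m + suc k ∸ suc m + 1  ∎
  where open ≡-Reasoning

1+m<m+n∸1 : ∀ m {n} → 3 ≤ n → suc m < m + n ∸ 1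
1+m<m+n∸1 m {suc (suc (suc k))} _ rewrite +-suc m (suc (suc k)) | +-suc m (suc k) | +-suc m k =
  s≤s (s≤s (m≤m+n m k))
1+m<m+n∸1 m {1} (s≤s ())
1+m<m+n∸1 m {2} (s≤s (s≤s ()))

[1+k]k/2≡k[k∸1]/2+k : ∀ k → suc k * k / 2 ≡ k * (k ∸ 1) / 2 + k
[1+k]k/2≡k[k∸1]/2+k k = begin
  suc k * k / 2                  ≡⟨ cong (_/ 2) (expand k) ⟩
  (k * (k ∸ 1) + k * 2) / 2      ≡⟨ +-distrib-/-∣ʳ (k * (k ∸ 1)) (divides-refl k) ⟩
  k * (k ∸ 1) / 2 + k * 2 / 2    ≡⟨ cong (k * (k ∸ 1) / 2 +_) (m*n/n≡m k 2) ⟩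
  k * (k ∸ 1) / 2 + k            ∎
  where
  open ≡-Reasoning
  expand : ∀ k → suc k * k ≡ k * (k ∸ 1) + k * 2
  expand zero    = refl
  expand (suc j) = begin
    suc (suc j) * suc j  ≡⟨ *-comm (suc (suc j)) (suc j) ⟩
    suc j * suc (suc j)  ≡⟨ cong (suc j *_) (+-comm 2 j) ⟩
    suc j * (j + 2)      ≡⟨ *-distribˡ-+ (suc j) j 2 ⟩
    suc j * j + suc j * 2  ∎

∑ : List A → (A → ℕ) → ℕ
∑ xs f = sum (map f xs)

syntax ∑ xs (λ x → e) = ∑[ x ∈ xs ] e

𝟙 : ∀ {P : Set} → Dec P → ℕ
𝟙 (yes _) = 1
𝟙 (no _)  = 0

length-filter≡∑𝟙 : ∀ {P : A → Set} (P? : Decidable P) xs → length (filter P? xs) ≡ ∑[ x ∈ xs ] 𝟙 (P? x)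
length-filter≡∑𝟙 P? []       = refl
length-filter≡∑𝟙 P? (x ∷ xs) with P? x
... | yes _ = cong suc (length-filter≡∑𝟙 P? xs)
... | no _  = length-filter≡∑𝟙 P? xs

∑-cong : ∀ {f g : A → ℕ} xs → (∀ {x} → x ∈ xs → f x ≡ g x) → ∑ xs f ≡ ∑ xs g
∑-cong []       _   = refl
∑-cong (x ∷ xs) f≗g = cong₂ _+_ (f≗g (here refl)) (∑-cong xs (f≗g ∘ there))

∑-zero : ∀ {f : A → ℕ} xs → (∀ {x} → x ∈ xs → f x ≡ 0) → ∑ xs f ≡ 0
∑-zero []       _   = refl
∑-zero (x ∷ xs) f≗0 = cong₂ _+_ (f≗0 (here refl)) (∑-zero xs (f≗0 ∘ there))

∑-+ : ∀ (f g : A → ℕ) xs → ∑[ x ∈ xs ] (f x + g x) ≡ ∑ xs f + ∑ xs g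
∑-+ f g []       = refl
∑-+ f g (x ∷ xs) = trans (cong (f x + g x +_) (∑-+ f g xs)) (interchange (f x) (g x) (∑ xs f) (∑ xs g))

*-distribˡ-∑ : ∀ c (f : A → ℕ) xs → c * ∑ xs f ≡ ∑[ x ∈ xs ] (c * f x)
*-distribˡ-∑ c f []       = *-zeroʳ c
*-distribˡ-∑ c f (x ∷ xs) = trans (*-distribˡ-+ c (f x) (∑ xs f)) (cong (c * f x +_) (*-distribˡ-∑ c f xs))

∑-comm : ∀ (f : A → B → ℕ) xs ys → ∑[ x ∈ xs ] ∑ ys (f x) ≡ ∑[ y ∈ ys ] ∑[ x ∈ xs ] f x y
∑-comm f []       ys = sym (∑-zero ys (λ _ → refl))
∑-comm f (x ∷ xs) ys = trans (cong (∑ ys (f x) +_) (∑-comm f xs ys)) (sym (∑-+ (f x) _ ys))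

∑-single : ∀ {f : A → ℕ} {a xs} → Unique xs → a ∈ xs → (∀ {x} → x ∈ xs → x ≢ a → f x ≡ 0) → ∑ xs f ≡ f a
∑-single {f = f} {xs = x ∷ xs} (x∉xs ∷ _) (here refl) f≗0 =
  trans (cong (f x +_) (∑-zero xs λ y∈xs → f≗0 (there y∈xs) (≢-sym (All.lookup x∉xs y∈xs)))) (+-identityʳ (f x))
∑-single {f = f} {xs = x ∷ xs} (x∉xs ∷ xs-unique) (there a∈xs) f≗0 =
  cong₂ _+_ (f≗0 (here refl) (All.lookup x∉xs a∈xs)) (∑-single xs-unique a∈xs (f≗0 ∘ there))

∑-1≡length : ∀ (xs : List A) → ∑[ x ∈ xs ] 1 ≡ length xs
∑-1≡length []       = refl
∑-1≡length (_ ∷ xs) = cong suc (∑-1≡length xs)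

𝟙-yes : ∀ {P : Set} (P? : Dec P) → P → 𝟙 P? ≡ 1
𝟙-yes (yes _) _  = refl
𝟙-yes (no ¬p) p  = contradiction p ¬p

𝟙*𝟙≡0 : ∀ {P Q : Set} (P? : Dec P) (Q? : Dec Q) → (P → Q → ⊥ₑ) → 𝟙 P? * 𝟙 Q? ≡ 0
𝟙*𝟙≡0 (yes p) (yes q) ¬p∧q = contradiction q (¬p∧q p)
𝟙*𝟙≡0 (yes _) (no _)  _    = refl
𝟙*𝟙≡0 (no _)  _       _    = refl

𝟙[𝟙+k≡2] : ∀ {P : Set} (P? : Dec P) k → 𝟙 P? + k ≤ 2 → 𝟙 (𝟙 P? + k ≟ 2) ≡ 𝟙 (k ≟ 2) + 𝟙 P? * k
𝟙[𝟙+k≡2] (no _)  k             _               = sym (+-identityʳ _)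
𝟙[𝟙+k≡2] (yes _) 0             _               = refl
𝟙[𝟙+k≡2] (yes _) 1             _               = refl
𝟙[𝟙+k≡2] (yes _) (suc (suc k)) (s≤s (s≤s ()))

-- Double counting

module DoubleCounting {R : A → B → Set} (R? : ∀ a b → Dec (R a b)) {as : List A} (as-unique : Unique as) where

  deg : List B → A → ℕ
  deg bs a = length (filter (R? a) bs)

  deg-∷ : ∀ a b bs → deg (b ∷ bs) a ≡ 𝟙 (R? a b) + deg bs a
  deg-∷ a b bs with R? a b
  ... | yes _ = refl
  ... | no _  = refl

  UniqueCommonLower : B → B → Set
  UniqueCommonLower b b' = ∃! _≡_ λ a → a ∈ as × R a b × R a b'

  ∑[𝟙*deg]≡length : ∀ b bs → (∀ {b'} → b' ∈ bs → UniqueCommonLower b b') →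
                    ∑[ a ∈ as ] (𝟙 (R? a b) * deg bs a) ≡ length bs
  ∑[𝟙*deg]≡length b bs common = begin
    ∑[ a ∈ as ] (𝟙 (R? a b) * deg bs a)                     ≡⟨ ∑-cong as (λ {a} _ → expand a) ⟩
    ∑[ a ∈ as ] ∑[ b' ∈ bs ] (𝟙 (R? a b) * 𝟙 (R? a b'))     ≡⟨ ∑-comm _ as bs ⟩
    ∑[ b' ∈ bs ] ∑[ a ∈ as ] (𝟙 (R? a b) * 𝟙 (R? a b'))     ≡⟨ ∑-cong bs exactly-one ⟩
    ∑[ b' ∈ bs ] 1                                          ≡⟨ ∑-1≡length bs ⟩
    length bs                                               ∎
    where
    open ≡-Reasoning
    expand : ∀ a → 𝟙 (R? a b) * deg bs a ≡ ∑[ b' ∈ bs ] (𝟙 (R? a b) * 𝟙 (R? a b'))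
    expand a = trans (cong (𝟙 (R? a b) *_) (length-filter≡∑𝟙 (R? a) bs)) (*-distribˡ-∑ (𝟙 (R? a b)) (𝟙 ∘ R? a) bs)
    exactly-one : ∀ {b'} → b' ∈ bs → ∑[ a ∈ as ] (𝟙 (R? a b) * 𝟙 (R? a b')) ≡ 1
    exactly-one {b'} b'∈bs with a , (a∈as , Rab , Rab') , unique ← common b'∈bs =
      trans (∑-single as-unique a∈as λ x∈as x≢a →
               𝟙*𝟙≡0 (R? _ b) (R? _ b') λ Rxb Rxb' → x≢a (sym (unique (x∈as , Rxb , Rxb'))))
            (cong₂ _*_ (𝟙-yes (R? a b) Rab) (𝟙-yes (R? a b') Rab'))

  #deg≡2 : ∀ bs → Unique bs → (∀ {a} → a ∈ as → deg bs a ≤ 2) →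
           (∀ {b b'} → b ∈ bs → b' ∈ bs → b ≢ b' → UniqueCommonLower b b') →
           length (filter (λ a → deg bs a ≟ 2) as) ≡ length bs * (length bs ∸ 1) / 2
  #deg≡2 [] _ _ _ = cong length (filter-none (λ a → deg [] a ≟ 2) (All.universal (λ _ ()) as))
  #deg≡2 (b ∷ bs) (b∉bs ∷ bs-unique) deg≤2 common = begin
    length (filter (λ a → deg (b ∷ bs) a ≟ 2) as)
      ≡⟨ length-filter≡∑𝟙 _ as ⟩
    ∑[ a ∈ as ] 𝟙 (deg (b ∷ bs) a ≟ 2)
      ≡⟨ ∑-cong as step ⟩
    ∑[ a ∈ as ] (𝟙 (deg bs a ≟ 2) + 𝟙 (R? a b) * deg bs a)
      ≡⟨ ∑-+ _ _ as ⟩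
    ∑[ a ∈ as ] 𝟙 (deg bs a ≟ 2) + ∑[ a ∈ as ] (𝟙 (R? a b) * deg bs a)
      ≡⟨ cong₂ _+_ (sym (length-filter≡∑𝟙 _ as)) (∑[𝟙*deg]≡length b bs common-with-b) ⟩
    length (filter (λ a → deg bs a ≟ 2) as) + length bs
      ≡⟨ cong (_+ length bs) (#deg≡2 bs bs-unique deg≤2′ (λ b∈ b'∈ → common (there b∈) (there b'∈))) ⟩
    length bs * (length bs ∸ 1) / 2 + length bs
      ≡⟨ [1+k]k/2≡k[k∸1]/2+k (length bs) ⟨
    suc (length bs) * length bs / 2
      ∎
    where
    open ≡-Reasoning
    step : ∀ {a} → a ∈ as → 𝟙 (deg (b ∷ bs) a ≟ 2) ≡ 𝟙 (deg bs a ≟ 2) + 𝟙 (R? a b) * deg bs a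
    step {a} a∈as rewrite deg-∷ a b bs = 𝟙[𝟙+k≡2] (R? a b) (deg bs a) (subst (_≤ 2) (deg-∷ a b bs) (deg≤2 a∈as))
    deg≤2′ : ∀ {a} → a ∈ as → deg bs a ≤ 2
    deg≤2′ {a} a∈as = ≤-trans (subst (deg bs a ≤_) (sym (deg-∷ a b bs)) (m≤n+m _ _)) (deg≤2 a∈as)
    common-with-b : ∀ {b'} → b' ∈ bs → UniqueCommonLower b b'
    common-with-b b'∈bs = common (here refl) (there b'∈bs) (All.lookup b∉bs b'∈bs)

-- The two top layers of H

module TwoTopLayers {H : List (Subset n)} (H-unique : Unique H) (nonempty : ∀ {x} → x ∈ H → x ≢ ⊥)
                    (closed : ClosedUnderIntersection H) where

  ℓ : ℕ
  ℓ = maxCard H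

  h : ℕ
  h = length (upper H)

  N′ : Subset n
  N′ = ⋃ (upper H)

  ∈-upper⁻ : ∀ {x} → x ∈ upper H → x ∈ H × ∣ x ∣ ≡ ℓ
  ∈-upper⁻ = ∈-filter⁻ (λ x → ∣ x ∣ ≟ ℓ) {xs = H}

  ∈-lower⁻ : ∀ {y} → y ∈ lower H → y ∈ H × ∣ y ∣ ≡ ℓ ∸ 1
  ∈-lower⁻ = ∈-filter⁻ (λ y → ∣ y ∣ ≟ ℓ ∸ 1) {xs = H}

  ∈-prec⁻ : ∀ {x y} → x ∈ prec H y → x ∈ upper H × y ⊆ x
  ∈-prec⁻ {y = y} = ∈-filter⁻ (y ⊆?_) {xs = upper H}

  ∈-prec⁺ : ∀ {x y} → x ∈ upper H → y ⊆ x → x ∈ prec H y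
  ∈-prec⁺ {y = y} = ∈-filter⁺ (y ⊆?_) {xs = upper H}

  upper-unique : Unique (upper H)
  upper-unique = filter⁺ (λ x → ∣ x ∣ ≟ ℓ) H-unique

  lower-unique : Unique (lower H)
  lower-unique = filter⁺ (λ y → ∣ y ∣ ≟ ℓ ∸ 1) H-unique

  prec-unique : ∀ y → Unique (prec H y)
  prec-unique y = filter⁺ (y ⊆?_) upper-unique

  ∣upper∣≡ℓ : ∀ {x} → x ∈ upper H → ∣ x ∣ ≡ ℓ
  ∣upper∣≡ℓ x∈ = proj₂ (∈-upper⁻ x∈)

  ∣x∩x′∣≡ℓ∸1 : ∀ {x x′} → x ∈ upper H → x′ ∈ upper H → x ≢ x′ → ∣ x ∩ x′ ∣ ≡ ℓ ∸ 1
  ∣x∩x′∣≡ℓ∸1 {x} {x′} x∈ x′∈ x≢x′ = proj₂ (∈-lower⁻ (closed x x′ x∈ x′∈ x≢x′))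

  suc[ℓ∸1]≡ℓ : ∀ {x} → x ∈ upper H → suc (ℓ ∸ 1) ≡ ℓ
  suc[ℓ∸1]≡ℓ x∈upper with x∈H , ∣x∣≡ℓ ← ∈-upper⁻ x∈upper =
    suc-pred ℓ {{≢-nonZero (λ ℓ≡0 → p≢⊥⇒∣p∣≢0 (nonempty x∈H) (trans ∣x∣≡ℓ ℓ≡0))}}

  lower⊆both⇒≡∩ : ∀ {x x′ y} → x ∈ upper H → x′ ∈ upper H → x ≢ x′ →
                  y ∈ lower H → y ⊆ x → y ⊆ x′ → y ≡ x ∩ x′
  lower⊆both⇒≡∩ {x} {x′} x∈ x′∈ x≢x′ y∈ y⊆x y⊆x′ =
    p⊆q∧∣q∣≤∣p∣⇒p≡q (∩-glb y⊆x y⊆x′)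
      (≤-reflexive (trans (∣x∩x′∣≡ℓ∸1 x∈ x′∈ x≢x′) (sym (proj₂ (∈-lower⁻ y∈)))))

  ∣x∪x′∣≡1+ℓ : ∀ {x x′} → x ∈ upper H → x′ ∈ upper H → x ≢ x′ → ∣ x ∪ x′ ∣ ≡ suc ℓ
  ∣x∪x′∣≡1+ℓ {x} {x′} x∈ x′∈ x≢x′ = +-cancelʳ-≡ (ℓ ∸ 1) _ _ (begin
    ∣ x ∪ x′ ∣ + (ℓ ∸ 1)      ≡⟨ cong (∣ x ∪ x′ ∣ +_) (∣x∩x′∣≡ℓ∸1 x∈ x′∈ x≢x′) ⟨
    ∣ x ∪ x′ ∣ + ∣ x ∩ x′ ∣   ≡⟨ ∣p∪q∣+∣p∩q∣≡∣p∣+∣q∣ x x′ ⟩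
    ∣ x ∣ + ∣ x′ ∣            ≡⟨ cong₂ _+_ (∣upper∣≡ℓ x∈) (∣upper∣≡ℓ x′∈) ⟩
    ℓ + ℓ                     ≡⟨ cong (ℓ +_) (suc[ℓ∸1]≡ℓ x∈) ⟨
    ℓ + suc (ℓ ∸ 1)           ≡⟨ +-suc ℓ (ℓ ∸ 1) ⟩
    suc ℓ + (ℓ ∸ 1)           ∎)
    where open ≡-Reasoning

  module AtMostTwoPredecessors (deg≤2 : ∀ y → y ∈ lower H → length (prec H y) ≤ 2)
                               {x₀ x₁} (x₀∈ : x₀ ∈ upper H) (x₁∈ : x₁ ∈ upper H) (x₀≢x₁ : x₀ ≢ x₁) where

    x₀∩x₁⊈third : ∀ {z} → z ∈ upper H → z ≢ x₀ → z ≢ x₁ → ¬ (x₀ ∩ x₁ ⊆ z)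
    x₀∩x₁⊈third z∈ z≢x₀ z≢x₁ x₀∩x₁⊆z =
      ≤⇒≯ (deg≤2 _ (closed x₀ x₁ x₀∈ x₁∈ x₀≢x₁))
          (≢∧∈∧∈∧∈⇒3≤length (∈-prec⁺ x₀∈ (p∩q⊆p x₀ x₁)) (∈-prec⁺ x₁∈ (p∩q⊆q x₀ x₁)) (∈-prec⁺ z∈ x₀∩x₁⊆z)
                            x₀≢x₁ (≢-sym z≢x₀) (≢-sym z≢x₁))

    -- A third upper node z is the union of the lower nodes z ∩ x₀ and z ∩ x₁: their intersection is
    -- strictly inside x₀ ∩ x₁, so by inclusion–exclusion their union is too big to fit strictly inside z.
    third⊆x₀∪x₁ : ∀ {z} → z ∈ upper H → z ≢ x₀ → z ≢ x₁ → z ⊆ x₀ ∪ x₁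
    third⊆x₀∪x₁ {z} z∈ z≢x₀ z≢x₁ =
      ⊆-trans (⊆-reflexive (sym Z₀∪Z₁≡z)) (∪-lub (⊆-trans (p∩q⊆q z x₀) (p⊆p∪q x₁)) (⊆-trans (p∩q⊆q z x₁) (q⊆p∪q x₀ x₁)))
      where
      Z₀ Z₁ : Subset n
      Z₀ = z ∩ x₀
      Z₁ = z ∩ x₁
      Z₀∩Z₁⊂x₀∩x₁ : Z₀ ∩ Z₁ ⊂ x₀ ∩ x₁
      Z₀∩Z₁⊂x₀∩x₁ = [ (λ Z₀∩Z₁≡x₀∩x₁ → ⊥-elim (x₀∩x₁⊈third z∈ z≢x₀ z≢x₁
                                   (⊆-trans (⊆-reflexive (sym Z₀∩Z₁≡x₀∩x₁)) (⊆-trans (p∩q⊆p Z₀ Z₁) (p∩q⊆p z x₀)))))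
                    , (λ Z₀∩Z₁⊂x₀∩x₁ → Z₀∩Z₁⊂x₀∩x₁) ]′
                    (p⊆q⇒p≡q⊎p⊂q (∩-glb (⊆-trans (p∩q⊆p Z₀ Z₁) (p∩q⊆q z x₀)) (⊆-trans (p∩q⊆q Z₀ Z₁) (p∩q⊆q z x₁))))
      ∣Z₀∩Z₁∣<ℓ∸1 : ∣ Z₀ ∩ Z₁ ∣ < ℓ ∸ 1
      ∣Z₀∩Z₁∣<ℓ∸1 = subst (∣ Z₀ ∩ Z₁ ∣ <_) (∣x∩x′∣≡ℓ∸1 x₀∈ x₁∈ x₀≢x₁) (p⊂q⇒∣p∣<∣q∣ Z₀∩Z₁⊂x₀∩x₁)
      ℓ∸1<∣Z₀∪Z₁∣ : ℓ ∸ 1 < ∣ Z₀ ∪ Z₁ ∣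
      ℓ∸1<∣Z₀∪Z₁∣ = ≰⇒> λ ∣Z₀∪Z₁∣≤ℓ∸1 → <-irrefl
        (trans (∣p∪q∣+∣p∩q∣≡∣p∣+∣q∣ Z₀ Z₁)
               (cong₂ _+_ (∣x∩x′∣≡ℓ∸1 z∈ x₀∈ z≢x₀) (∣x∩x′∣≡ℓ∸1 z∈ x₁∈ z≢x₁)))
        (+-mono-≤-< ∣Z₀∪Z₁∣≤ℓ∸1 ∣Z₀∩Z₁∣<ℓ∸1)
      Z₀∪Z₁≡z : Z₀ ∪ Z₁ ≡ z
      Z₀∪Z₁≡z = p⊆q∧∣q∣≤∣p∣⇒p≡q (∪-lub (p∩q⊆p z x₀) (p∩q⊆p z x₁))
                (subst (_≤ ∣ Z₀ ∪ Z₁ ∣) (trans (suc[ℓ∸1]≡ℓ z∈) (sym (∣upper∣≡ℓ z∈))) ℓ∸1<∣Z₀∪Z₁∣)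

    upper⊆x₀∪x₁ : ∀ {z} → z ∈ upper H → z ⊆ x₀ ∪ x₁
    upper⊆x₀∪x₁ {z} z∈ with z ≟ₛ x₀ | z ≟ₛ x₁
    ... | yes refl | _        = p⊆p∪q x₁
    ... | no _     | yes refl = q⊆p∪q x₀ x₁
    ... | no z≢x₀  | no z≢x₁  = third⊆x₀∪x₁ z∈ z≢x₀ z≢x₁

    ∣N′∣≡1+ℓ : ∣ N′ ∣ ≡ suc ℓ
    ∣N′∣≡1+ℓ = trans (cong ∣_∣ N′≡x₀∪x₁) (∣x∪x′∣≡1+ℓ x₀∈ x₁∈ x₀≢x₁)
      where
      N′≡x₀∪x₁ : N′ ≡ x₀ ∪ x₁
      N′≡x₀∪x₁ = ⊆-antisym (⋃-lub (upper H) upper⊆x₀∪x₁) (∪-lub (p∈xs⇒p⊆⋃xs x₀∈) (p∈xs⇒p⊆⋃xs x₁∈))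

    ℓ≡∣N′∣∸1 : ℓ ≡ ∣ N′ ∣ ∸ 1
    ℓ≡∣N′∣∸1 = cong (_∸ 1) (sym ∣N′∣≡1+ℓ)

    upper≡N′-i : ∀ x → x ∈ upper H → ∃[ i ] (i ∈ₛ N′ × x ≡ N′ - i)
    upper≡N′-i x x∈ = p⊆q∧∣q∣≡1+∣p∣⇒p≡q-x (p∈xs⇒p⊆⋃xs x∈) (trans ∣N′∣≡1+ℓ (cong suc (sym (∣upper∣≡ℓ x∈))))

    #two-predecessors : length (filter (λ y → length (prec H y) ≟ 2) (lower H)) ≡ h * (h ∸ 1) / 2
    #two-predecessors = DoubleCounting.#deg≡2 _⊆?_ lower-unique (upper H) upper-unique (deg≤2 _) unique-common
      where
      unique-common : ∀ {x x′} → x ∈ upper H → x′ ∈ upper H → x ≢ x′ →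
                      DoubleCounting.UniqueCommonLower _⊆?_ lower-unique x x′
      unique-common {x} {x′} x∈ x′∈ x≢x′ =
        x ∩ x′ , (closed x x′ x∈ x′∈ x≢x′ , p∩q⊆p x x′ , p∩q⊆q x x′) ,
        λ (y∈ , y⊆x , y⊆x′) → sym (lower⊆both⇒≡∩ x∈ x′∈ x≢x′ y∈ y⊆x y⊆x′)

  module PredecessorOfAll (3≤h : 3 ≤ h) {S} (S∈ : S ∈ lower H) (prec-S≡h : length (prec H S) ≡ h) where

    S⊆upper : ∀ {x} → x ∈ upper H → S ⊆ x
    S⊆upper {x} x∈ = proj₂ (∈-prec⁻ (subst (x ∈_) (sym (filter-complete (S ⊆?_) prec-S≡h)) x∈))

    0<h : 0 < h
    0<h = ≤-trans (s≤s z≤n) 3≤h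

    ℓ≡1+∣S∣ : ℓ ≡ suc ∣ S ∣
    ℓ≡1+∣S∣ = trans (sym (suc[ℓ∸1]≡ℓ (proj₂ (0<length⇒∃∈ 0<h)))) (cong suc (sym (proj₂ (∈-lower⁻ S∈))))

    S⊆N′ : S ⊆ N′
    S⊆N′ = let x , x∈ = 0<length⇒∃∈ 0<h in ⊆-trans (S⊆upper x∈) (p∈xs⇒p⊆⋃xs x∈)

    upper-extends-S : ∀ {x} → x ∈ upper H → OnePointExtension S x
    upper-extends-S x∈ = p⊆q∧∣q∣≡1+∣p∣⇒q≡p∪⁅x⁆ (S⊆upper x∈) (trans (∣upper∣≡ℓ x∈) ℓ≡1+∣S∣)

    ∣N′∣≡∣S∣+h : ∣ N′ ∣ ≡ ∣ S ∣ + h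
    ∣N′∣≡∣S∣+h = trans (cong ∣_∣ (sym S∪N′≡N′)) (∣p∪⋃xs∣≡∣p∣+length upper-unique upper-extends-S)
      where
      S∪N′≡N′ : S ∪ N′ ≡ N′
      S∪N′≡N′ = ⊆-antisym (∪-lub S⊆N′ ⊆-refl) (q⊆p∪q S N′)

    h≡∣N′∣∸ℓ+1 : h ≡ ∣ N′ ∣ ∸ ℓ + 1
    h≡∣N′∣∸ℓ+1 = subst₂ (λ n′ ℓ′ → h ≡ n′ ∸ ℓ′ + 1) (sym ∣N′∣≡∣S∣+h) (sym ℓ≡1+∣S∣) (n≡m+n∸[1+m]+1 ∣ S ∣ 0<h)

    ℓ<∣N′∣∸1 : ℓ < ∣ N′ ∣ ∸ 1
    ℓ<∣N′∣∸1 = subst₂ (λ ℓ′ n′ → ℓ′ < n′ ∸ 1) (sym ℓ≡1+∣S∣) (sym ∣N′∣≡∣S∣+h) (1+m<m+n∸1 ∣ S ∣ 3≤h)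

    upper∋i∉S⇒≡S∪⁅i⁆ : ∀ {y i} → y ∈ upper H → i ∈ₛ y → i ∉ S → y ≡ S ∪ ⁅ i ⁆
    upper∋i∉S⇒≡S∪⁅i⁆ {y} {i} y∈ i∈y i∉S = trans y≡S∪⁅j⁆ (cong (λ k → S ∪ ⁅ k ⁆) (sym i≡j))
      where
      j = proj₁ (upper-extends-S y∈)
      y≡S∪⁅j⁆ = proj₂ (proj₂ (upper-extends-S y∈))
      i≡j : i ≡ j
      i≡j = [ (λ i∈S → contradiction i∈S i∉S) , x∈⁅y⁆⇒x≡y j ]′ (x∈p∪q⁻ S ⁅ j ⁆ (subst (i ∈ₛ_) y≡S∪⁅j⁆ i∈y))

    upper⇔S∪⁅i⁆ : ∀ x → x ∈ upper H ⇔ (∃[ i ] (i ∈ₛ N′ × i ∉ S × x ≡ S ∪ ⁅ i ⁆))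
    upper⇔S∪⁅i⁆ x = mk⇔ to from
      where
      to : x ∈ upper H → ∃[ i ] (i ∈ₛ N′ × i ∉ S × x ≡ S ∪ ⁅ i ⁆)
      to x∈ = let i , i∉S , x≡S∪⁅i⁆ = upper-extends-S x∈ in
        i , p∈xs⇒p⊆⋃xs x∈ (subst (i ∈ₛ_) (sym x≡S∪⁅i⁆) (q⊆p∪q S ⁅ i ⁆ (x∈⁅x⁆ i))) , i∉S , x≡S∪⁅i⁆
      from : ∃[ i ] (i ∈ₛ N′ × i ∉ S × x ≡ S ∪ ⁅ i ⁆) → x ∈ upper H
      from (i , i∈N′ , i∉S , x≡S∪⁅i⁆) with y , y∈ , i∈y ← i∈⋃xs⇒∃x (upper H) i∈N′ =
        subst (_∈ upper H) (trans (upper∋i∉S⇒≡S∪⁅i⁆ y∈ i∈y i∉S) (sym x≡S∪⁅i⁆)) y∈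

    lower≢S⇒#prec≤1 : ∀ T → T ∈ lower H → T ≢ S → length (prec H T) ≤ 1
    lower≢S⇒#prec≤1 T T∈ T≢S = ≮⇒≥ λ 2≤#prec →
      let a , b , a∈ , b∈ , a≢b = Unique∧2≤length⇒∃≢ (prec-unique T) 2≤#prec
          a∈upper , T⊆a = ∈-prec⁻ a∈
          b∈upper , T⊆b = ∈-prec⁻ b∈
      in T≢S (trans (lower⊆both⇒≡∩ a∈upper b∈upper a≢b T∈ T⊆a T⊆b)
                    (sym (lower⊆both⇒≡∩ a∈upper b∈upper a≢b S∈ (S⊆upper a∈upper) (S⊆upper b∈upper))))

proposition5 : (n : ℕ) (H : List (Subset n)) → Unique H
    → (∀ x → x ∈ H → x ≢ ⊥ × x ≢ ⊤)
    → ClosedUnderIntersection H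
    → let h = length (upper H)
          ℓ = maxCard H
          N' = ⋃ (upper H)
          n' = ∣ N' ∣
      in ((∀ y → y ∈ lower H → length (prec H y) ≤ 2) → 2 ≤ h
            → (ℓ ≡ n' ∸ 1)
              × (∀ x → x ∈ upper H → ∃[ i ] (i ∈ₛ N' × x ≡ N' - i))
              × (length (filter (λ y → length (prec H y) ≟ 2) (lower H)) ≡ h * (h ∸ 1) / 2))
         × (3 ≤ h → (S : Subset n) → S ∈ lower H → length (prec H S) ≡ h
            → (h ≡ n' ∸ ℓ + 1)
              × (ℓ < n' ∸ 1)
              × (∀ x → ((x ∈ upper H) ⇔ (∃[ i ] (i ∈ₛ N' × i ∉ S × x ≡ S ∪ ⁅ i ⁆))))
              × (∀ T → T ∈ lower H → T ≢ S → length (prec H T) ≤ 1))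
proposition5 n H H-unique proper closed =
  (λ deg≤2 2≤h →
     let x₀ , x₁ , x₀∈ , x₁∈ , x₀≢x₁ = Unique∧2≤length⇒∃≢ upper-unique 2≤h
         open AtMostTwoPredecessors deg≤2 x₀∈ x₁∈ x₀≢x₁
     in ℓ≡∣N′∣∸1 , upper≡N′-i , #two-predecessors) ,
  (λ 3≤h S S∈ prec-S≡h →
     let open PredecessorOfAll 3≤h S∈ prec-S≡h
     in h≡∣N′∣∸ℓ+1 , ℓ<∣N′∣∸1 , upper⇔S∪⁅i⁆ , lower≢S⇒#prec≤1)
  where
  open TwoTopLayers H-unique (proj₁ ∘ proper _) closed
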